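{- Let $\Gamma=(V,E)$ be a distance-biregular graph on $n$ vertices with stable sets $V=V_0\cup V_1$. Then for each $\ell\in\{0,1\}$ there exist real numbers $q_{\ell,0},q_{\ell,1},\dots,q_{\ell,D_\ell}$ such that for every $x\in V_\ell$ and every $y\in V$, $$\nu^{x}(y)=q_{\ell,m}\iff d(x,y)=m,\qquad m=0,\ldots,D_\ell .$$ Moreover, $$q_{\ell,m}=\sum_{j=0}^{m-1}\frac{n-B_{\ell,j}}{k_{\ell,j}\,b_{\ell,j}}=\sum_{j=1}^{m}\frac{n-B_{\ell,j-1}}{k_{\ell,j}\,c_{\ell,j}},\qquad m=0,\dots,D_\ell .$$ In particular $q_{\ell,1}=\dfrac{n-1}{k_\ell}$ and $q_{\ell,2}=\dfrac{n-1}{k_\ell}+\dfrac{n-1-k_\ell}{k_\ell(k_{\bar\ell}-1)}$, where $\bar\ell=1-\ell$.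
   Context: All graphs are finite, connected, simple (unweighted), with $n=|V|\ge 2$; $d(x,y)$ is the graph distance, $\Gamma_i(x)=\{y: d(x,y)=i\}$. The (combinatorial) Laplacian acts on functions $u:V\to\mathbb R$ by $\mathcal L(u)(x)=\sum_{y\sim x}(u(x)-u(y))$. For $y\in V$, the equilibrium measure of $V\setminus\{y\}$ is the unique function $\nu^y:V\to\mathbb R$ with $\nu^y(y)=0$, $\nu^y(x)>0$ for $x\ne y$, and $\mathcal L(\nu^y)=\mathbf 1-n\varepsilon_y$ on $V$ (where $\mathbf 1$ is the all-ones function and $\varepsilon_y$ the indicator of $y$). A graph is semiregular if it is bipartite with stable sets $V_0,V_1$ and every vertex of $V_\ell$ has degree $k_\ell$ ($\ell=0,1$). Let $D_\ell=\max\{d(x,y): x\in V_\ell, y\in V\}$; the labelling is chosen so that $D_0\le D_1$, and $\bar\ell=1-\ell$. A connected graph is distance-biregular if it is semiregular and for any two vertices $x,y$ at distance $i$ the numbers $|\Gamma_{i-1}(x)\cap\Gamma_1(y)|$ and $|\Gamma_{i+1}(x)\cap\Gamma_1(y)|$ depend only on $i$ and on the stable set containing $x$; for $x\in V_\ell$ these are denoted $c_{\ell,i}$ and $b_{\ell,i}$ ($i=0,\dots,D_\ell$, with $c_{\ell,0}=b_{\ell,D_\ell}=0$). For $x\in V_\ell$ set $k_{\ell,i}=|\Gamma_i(x)|$ (independent of $x\in V_\ell$) and $B_{\ell,i}=\sum_{j=0}^{i}k_{\ell,j}$.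
   Formalization: The equilibrium measure $\nu^{x}$ ranges only over functions with values in ℚ rather than ℝ, and the numbers $q_{\ell,m}$ are taken in ℚ. -}

module Defs where

open import Data.Nat using (ℕ; zero; suc; _∸_; _≤_)
import Data.Nat as ℕ
open import Data.Fin using (Fin; zero; suc; _≟_)
open import Data.Bool using (Bool; true; false; _∧_; _∨_; not; if_then_else_)
open import Data.Integer using (+_)
open import Data.Rational using (ℚ; 0ℚ; 1ℚ; _+_; _-_; _*_; _/_; _<_)
open import Data.Product using (Σ; _×_; ∃)
open import Relation.Binary.PropositionalEquality using (_≡_; _≢_)
open import Relation.Nullary.Decidable using (⌊_⌋)

ℕtoℚ : ℕ → ℚ
ℕtoℚ m = + m / 1

-- total division of a rational by a natural number (convention: p ÷ℕ 0 = 0;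
-- only ever used with nonzero denominators in the statement's range)
_÷ℕ_ : ℚ → ℕ → ℚ
p ÷ℕ zero = 0ℚ
p ÷ℕ suc d = p * (+ 1 / suc d)

sumFin : ∀ {n} → (Fin n → ℚ) → ℚ
sumFin {zero} f = 0ℚ
sumFin {suc n} f = f zero + sumFin (λ i → f (suc i))

sumTo : ℕ → (ℕ → ℚ) → ℚ
sumTo zero f = 0ℚ
sumTo (suc m) f = sumTo m f + f m

sumℕ : ℕ → (ℕ → ℕ) → ℕ
sumℕ zero f = f zero
sumℕ (suc m) f = sumℕ m f ℕ.+ f (suc m)

count : ∀ {n} → (Fin n → Bool) → ℕ
count {zero} P = 0
count {suc n} P = (if P zero then 1 else 0) ℕ.+ count (λ i → P (suc i))

anyFin : ∀ {n} → (Fin n → Bool) → Bool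
anyFin {zero} P = false
anyFin {suc n} P = P zero ∨ anyFin (λ i → P (suc i))

record Graph (n : ℕ) : Set where
  field
    adj    : Fin n → Fin n → Bool
    symm   : ∀ x y → adj x y ≡ adj y x
    irrefl : ∀ x → adj x x ≡ false
open Graph public

module _ {n : ℕ} (G : Graph n) where

  ball : Fin n → ℕ → Fin n → Bool
  ball x zero y = ⌊ x ≟ y ⌋
  ball x (suc m) y = ball x m y ∨ anyFin (λ z → ball x m z ∧ adj G z y)

  sphere : Fin n → ℕ → Fin n → Bool
  sphere x zero y = ball x zero y
  sphere x (suc m) y = ball x (suc m) y ∧ not (ball x m y)

  Dist : Fin n → Fin n → ℕ → Set
  Dist x y m = sphere x m y ≡ true

  Connected : Set
  Connected = ∀ x y → ∃ λ m → Dist x y m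

  degree : Fin n → ℕ
  degree x = count (adj G x)

  kk : Fin n → ℕ → ℕ
  kk x i = count (sphere x i)

  BB : Fin n → ℕ → ℕ
  BB x i = sumℕ i (kk x)

  laplacian : (Fin n → ℚ) → Fin n → ℚ
  laplacian u x = sumFin (λ y → if adj G x y then u x - u y else 0ℚ)

  IsEquilibrium : Fin n → (Fin n → ℚ) → Set
  IsEquilibrium y ν =
    (ν y ≡ 0ℚ) ×
    (∀ x → x ≢ y → 0ℚ < ν x) ×
    (∀ z → laplacian ν z ≡ 1ℚ - (if ⌊ z ≟ y ⌋ then ℕtoℚ n else 0ℚ))

  -- semiregular with stable sets V_ℓ = { x | side x ≡ ℓ } and degrees k ℓ
  Semiregular : (Fin n → Fin 2) → (Fin 2 → ℕ) → Set
  Semiregular side k =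
    (∀ x y → adj G x y ≡ true → side x ≢ side y) ×
    (∀ x → degree x ≡ k (side x))

  IsMaxDist : (Fin n → Fin 2) → (Fin 2 → ℕ) → Set
  IsMaxDist side D = ∀ ℓ →
    (∀ x y m → side x ≡ ℓ → Dist x y m → m ≤ D ℓ) ×
    (∃ λ x → ∃ λ y → side x ≡ ℓ × Dist x y (D ℓ))

  -- intersection numbers: for x ∈ V_ℓ, d(x,y) = i,
  -- |Γ_{i-1}(x) ∩ Γ_1(y)| = c ℓ i  (Γ_{-1} = ∅)  and  |Γ_{i+1}(x) ∩ Γ_1(y)| = b ℓ i
  HasIntersectionNumbers : (Fin n → Fin 2) → (Fin 2 → ℕ → ℕ) → (Fin 2 → ℕ → ℕ) → Set
  HasIntersectionNumbers side c b = ∀ x y i → Dist x y i →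
    (count (λ z → prevSphere x i z ∧ adj G y z) ≡ c (side x) i) ×
    (count (λ z → sphere x (suc i) z ∧ adj G y z) ≡ b (side x) i)
    where
    prevSphere : Fin n → ℕ → Fin n → Bool
    prevSphere x zero z = false
    prevSphere x (suc i) z = sphere x i z

  DistanceBiregular : (Fin n → Fin 2) → (Fin 2 → ℕ) → (Fin 2 → ℕ → ℕ) → (Fin 2 → ℕ → ℕ)
                      → (Fin 2 → ℕ) → Set
  DistanceBiregular side k c b D =
    Connected × Semiregular side k × HasIntersectionNumbers side c b × IsMaxDist side D

flip : Fin 2 → Fin 2
flip zero = suc zero
flip (suc zero) = zero

module Submission where

-- Fix x ∈ V_ℓ and consider the radial function y ↦ q(d(x,y)) with q m = Σ_{j<m} (n − B_j)/(k_j b_j).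
-- At a vertex at distance i+1 from x its Laplacian is c_{i+1}(q_{i+1} − q_i) − b_{i+1}(q_{i+2} − q_{i+1}),
-- which double counting of the edges between Γ_i(x) and Γ_{i+1}(x) (k_i b_i = k_{i+1} c_{i+1}) turns
-- into 1; at x it is 1 − n. On a connected graph a function with zero Laplacian is constant (maximum
-- principle), so this radial function is ν^x. The increments of q are positive below D_ℓ, hence q is
-- injective on 0..D_ℓ and the value ν^x(y) determines d(x,y).

open import Defs
import Algebra.Properties.CommutativeMonoid.Sum as CommutativeMonoidSum
open import Data.Bool using (Bool; true; false; _∧_; _∨_; not; if_then_else_)
open import Data.Bool.Properties using (∧-conicalˡ; ∧-conicalʳ; ∧-zeroʳ; ∧-identityʳ; ∧-idem; ∨-zeroʳ; ¬-not; not-involutive; T-≡)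
open import Data.Empty using (⊥-elim)
open import Data.Fin using (Fin; zero; suc; _≟_)
import Data.Integer as ℤ
open import Data.Integer using (+_)
import Data.Integer.Properties as ℤP
open import Data.Nat using (ℕ; zero; suc; _≤_; _<_; _∸_; z≤n; s≤s)
import Data.Nat as ℕ
import Data.Nat.Properties as ℕP
import Data.Nat.Coprimality as Coprime
open import Data.Product using (Σ; _×_; ∃; _,_; proj₁; proj₂)
open import Data.Rational using (ℚ; mkℚ; 0ℚ; 1ℚ; _+_; _-_; _*_; -_; _/_)
import Data.Rational as ℚ
import Data.Rational.Properties as ℚP
open import Data.Rational.Solver using (module +-*-Solver)
open import Data.Sum using (_⊎_; inj₁; inj₂)
open import Function using (Equivalence)
open import Function.Bundles using (_⇔_; mk⇔)
open import Relation.Binary.Definitions using (tri<; tri≈; tri>)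
open import Relation.Binary.PropositionalEquality
open import Relation.Nullary using (yes; no)
open import Relation.Nullary.Decidable using (⌊_⌋; isYes≗does; dec-true; dec-false; toWitness)

open +-*-Solver
open ≡-Reasoning

module ℕΣ = CommutativeMonoidSum ℕP.+-0-commutativeMonoid

ℕtoℚ≡mkℚ : ∀ a → ℕtoℚ a ≡ mkℚ (+ a) 0 (Coprime.sym (Coprime.1-coprimeTo a))
ℕtoℚ≡mkℚ a = ℚP.normalize-coprime (Coprime.sym (Coprime.1-coprimeTo a))

ℕtoℚ-+ : ∀ a b → ℕtoℚ (a ℕ.+ b) ≡ ℕtoℚ a + ℕtoℚ b
ℕtoℚ-+ a b rewrite ℕtoℚ≡mkℚ a | ℕtoℚ≡mkℚ b =
  ℚP./-cong {+ (a ℕ.+ b)} {1} (sym (cong₂ ℤ._+_ (ℤP.*-identityʳ (+ a)) (ℤP.*-identityʳ (+ b)))) refl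

ℕtoℚ-* : ∀ a b → ℕtoℚ (a ℕ.* b) ≡ ℕtoℚ a * ℕtoℚ b
ℕtoℚ-* a b rewrite ℕtoℚ≡mkℚ a | ℕtoℚ≡mkℚ b = ℚP./-cong {+ (a ℕ.* b)} {1} (ℤP.pos-* a b) refl

ℕtoℚ-∸ : ∀ a b → b ≤ a → ℕtoℚ (a ∸ b) ≡ ℕtoℚ a - ℕtoℚ b
ℕtoℚ-∸ a b b≤a = begin
  ℕtoℚ (a ∸ b)                   ≡⟨ solve 2 (λ x y → x := x :+ y :- y) refl (ℕtoℚ (a ∸ b)) (ℕtoℚ b) ⟩
  ℕtoℚ (a ∸ b) + ℕtoℚ b - ℕtoℚ b ≡⟨ cong (_- ℕtoℚ b) (sym (ℕtoℚ-+ (a ∸ b) b)) ⟩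
  ℕtoℚ (a ∸ b ℕ.+ b) - ℕtoℚ b    ≡⟨ cong (λ v → ℕtoℚ v - ℕtoℚ b) (ℕP.m∸n+n≡m b≤a) ⟩
  ℕtoℚ a - ℕtoℚ b                ∎

ℕtoℚ-positive : ∀ m → 1 ≤ m → ℚ.Positive (ℕtoℚ m)
ℕtoℚ-positive (suc m) _ = ℚP.normalize-pos (suc m) 1

ℕtoℚ-*-inverse : ∀ d → ℕtoℚ (suc d) * (+ 1 / suc d) ≡ 1ℚ
ℕtoℚ-*-inverse d rewrite ℕtoℚ≡mkℚ (suc d) | ℚP.normalize-coprime (Coprime.1-coprimeTo (suc d)) =
  ℚP.*-inverseʳ (mkℚ (+ suc d) 0 (Coprime.sym (Coprime.1-coprimeTo (suc d))))

inverse-unique : ∀ d u → ℕtoℚ (suc d) * u ≡ 1ℚ → u ≡ + 1 / suc d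
inverse-unique d u du≡1 = begin
  u            ≡⟨ sym (ℚP.*-identityˡ u) ⟩
  1ℚ * u       ≡⟨ cong (_* u) (sym (trans (ℚP.*-comm r k) (ℕtoℚ-*-inverse d))) ⟩
  r * k * u    ≡⟨ ℚP.*-assoc r k u ⟩
  r * (k * u)  ≡⟨ cong (r *_) du≡1 ⟩
  r * 1ℚ       ≡⟨ ℚP.*-identityʳ r ⟩
  r            ∎
  where
  k = ℕtoℚ (suc d)
  r = + 1 / suc d

÷ℕ-identityʳ : ∀ p → p ÷ℕ 1 ≡ p
÷ℕ-identityʳ = ℚP.*-identityʳ

÷ℕ-zeroˡ : ∀ d → 0ℚ ÷ℕ d ≡ 0ℚ
÷ℕ-zeroˡ zero    = refl
÷ℕ-zeroˡ (suc d) = ℚP.*-zeroˡ (+ 1 / suc d)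

ℕtoℚ-*-÷ℕ : ∀ p d → 1 ≤ d → ℕtoℚ d * (p ÷ℕ d) ≡ p
ℕtoℚ-*-÷ℕ p (suc d) _ = begin
  k * (p * r) ≡⟨ solve 3 (λ k p r → k :* (p :* r) := p :* (k :* r)) refl k p r ⟩
  p * (k * r) ≡⟨ cong (p *_) (ℕtoℚ-*-inverse d) ⟩
  p * 1ℚ      ≡⟨ ℚP.*-identityʳ p ⟩
  p           ∎
  where
  k = ℕtoℚ (suc d)
  r = + 1 / suc d

÷ℕ-* : ∀ p K C → 1 ≤ K → 1 ≤ C → p ÷ℕ (K ℕ.* C) ≡ (p ÷ℕ K) ÷ℕ C
÷ℕ-* p (suc K) (suc C) _ _ = begin
  p * rKC         ≡⟨ cong (p *_) (sym (inverse-unique (C ℕ.+ K ℕ.* suc C) (rK * rC) KC*rKrC≡1)) ⟩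
  p * (rK * rC)   ≡⟨ sym (ℚP.*-assoc p rK rC) ⟩
  p * rK * rC     ∎
  where
  rK = + 1 / suc K
  rC = + 1 / suc C
  rKC = + 1 / suc (C ℕ.+ K ℕ.* suc C)
  KC*rKrC≡1 : ℕtoℚ (suc K ℕ.* suc C) * (rK * rC) ≡ 1ℚ
  KC*rKrC≡1 = begin
    ℕtoℚ (suc K ℕ.* suc C) * (rK * rC)        ≡⟨ cong (_* (rK * rC)) (ℕtoℚ-* (suc K) (suc C)) ⟩
    ℕtoℚ (suc K) * ℕtoℚ (suc C) * (rK * rC)   ≡⟨ solve 4 (λ k c r s → k :* c :* (r :* s) := (k :* r) :* (c :* s))
                                                   refl (ℕtoℚ (suc K)) (ℕtoℚ (suc C)) rK rC ⟩
    (ℕtoℚ (suc K) * rK) * (ℕtoℚ (suc C) * rC) ≡⟨ cong₂ _*_ (ℕtoℚ-*-inverse K) (ℕtoℚ-*-inverse C) ⟩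
    1ℚ * 1ℚ                                    ≡⟨ ℚP.*-identityʳ 1ℚ ⟩
    1ℚ                                         ∎

ℕtoℚ-*-÷ℕ-* : ∀ p K C → 1 ≤ K → 1 ≤ C → ℕtoℚ C * (p ÷ℕ (K ℕ.* C)) ≡ p ÷ℕ K
ℕtoℚ-*-÷ℕ-* p K C 1≤K 1≤C =
  trans (cong (ℕtoℚ C *_) (÷ℕ-* p K C 1≤K 1≤C)) (ℕtoℚ-*-÷ℕ (p ÷ℕ K) C 1≤C)

÷ℕ-sub-denominator : ∀ p K → 1 ≤ K → p ÷ℕ K - (p - ℕtoℚ K) ÷ℕ K ≡ 1ℚ
÷ℕ-sub-denominator p (suc K) _ =
  trans (solve 3 (λ p k r → p :* r :- (p :- k) :* r := k :* r) refl p (ℕtoℚ (suc K)) (+ 1 / suc K))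
        (ℕtoℚ-*-inverse K)

ℕtoℚ-÷ℕ-positive : ∀ m d → 1 ≤ m → 1 ≤ d → 0ℚ ℚ.< ℕtoℚ m ÷ℕ d
ℕtoℚ-÷ℕ-positive m (suc d) 1≤m _ =
  ℚP.positive⁻¹ _ {{ℚP.pos*pos⇒pos (ℕtoℚ m) {{ℕtoℚ-positive m 1≤m}} (+ 1 / suc d) {{ℚP.normalize-pos 1 (suc d)}}}}

p≤q⇒0≤q-p : ∀ {p q} → p ℚ.≤ q → 0ℚ ℚ.≤ q - p
p≤q⇒0≤q-p {p} {q} p≤q = subst (ℚ._≤ q - p) (ℚP.+-inverseʳ p) (ℚP.+-monoˡ-≤ (- p) p≤q)

q-p≡0⇒p≡q : ∀ p q → q - p ≡ 0ℚ → p ≡ q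
q-p≡0⇒p≡q p q q-p≡0 = begin
  p             ≡⟨ solve 2 (λ p q → p := q :- (q :- p)) refl p q ⟩
  q - (q - p)   ≡⟨ cong (λ v → q - v) q-p≡0 ⟩
  q - 0ℚ        ≡⟨ solve 1 (λ q → q :- con 0ℚ := q) refl q ⟩
  q             ∎

p<p+q : ∀ p q → 0ℚ ℚ.< q → p ℚ.< p + q
p<p+q p q 0<q = subst (ℚ._< p + q) (ℚP.+-identityʳ p) (ℚP.+-monoʳ-< p 0<q)

nonneg+nonneg≡0 : ∀ {a b} → 0ℚ ℚ.≤ a → 0ℚ ℚ.≤ b → a + b ≡ 0ℚ → a ≡ 0ℚ × b ≡ 0ℚ
nonneg+nonneg≡0 {a} {b} 0≤a 0≤b a+b≡0 = a≡0 , b≡0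
  where
  a≡0 : a ≡ 0ℚ
  a≡0 = ℚP.≤-antisym (subst₂ ℚ._≤_ (ℚP.+-identityʳ a) a+b≡0 (ℚP.+-monoʳ-≤ a 0≤b)) 0≤a
  b≡0 : b ≡ 0ℚ
  b≡0 = trans (sym (ℚP.+-identityˡ b)) (trans (cong (_+ b) (sym a≡0)) a+b≡0)

true≢false : true ≢ false
true≢false ()

∨-true : ∀ a {b} → a ∨ b ≡ true → a ≡ true ⊎ b ≡ true
∨-true true  _   = inj₁ refl
∨-true false b≡t = inj₂ b≡t

anyFin-witness : ∀ {n} (P : Fin n → Bool) → anyFin P ≡ true → ∃ λ i → P i ≡ true
anyFin-witness {suc n} P any≡t with ∨-true (P zero) any≡t
... | inj₁ P0 = zero , P0
... | inj₂ rest with anyFin-witness (λ i → P (suc i)) rest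
...   | i , Pi = suc i , Pi

anyFin-intro : ∀ {n} (P : Fin n → Bool) i → P i ≡ true → anyFin P ≡ true
anyFin-intro {suc n} P zero    Pi = cong (_∨ anyFin (λ j → P (suc j))) Pi
anyFin-intro {suc n} P (suc i) Pi = trans (cong (P zero ∨_) (anyFin-intro (λ j → P (suc j)) i Pi)) (∨-zeroʳ (P zero))

≟⇒≡ : ∀ {n} {x y : Fin n} → ⌊ x ≟ y ⌋ ≡ true → x ≡ y
≟⇒≡ e = toWitness (Equivalence.from T-≡ e)

≟-refl : ∀ {n} (x : Fin n) → ⌊ x ≟ x ⌋ ≡ true
≟-refl x = trans (isYes≗does (x ≟ x)) (dec-true (x ≟ x) refl)

count-cong : ∀ {n} {P Q : Fin n → Bool} → (∀ i → P i ≡ Q i) → count P ≡ count Q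
count-cong {zero}  P≗Q = refl
count-cong {suc n} P≗Q = cong₂ (λ b m → (if b then 1 else 0) ℕ.+ m) (P≗Q zero) (count-cong (λ i → P≗Q (suc i)))

count-false : ∀ n → count {n} (λ _ → false) ≡ 0
count-false zero    = refl
count-false (suc n) = count-false n

count-true : ∀ n → count {n} (λ _ → true) ≡ n
count-true zero    = refl
count-true (suc n) = cong suc (count-true n)

count-≟ : ∀ {n} (x : Fin n) → count (λ z → ⌊ x ≟ z ⌋) ≡ 1
count-≟ {suc n} zero = cong suc (trans (count-cong {n} zero≢suc) (count-false n))
  where
  zero≢suc : ∀ i → ⌊ zero ≟ suc i ⌋ ≡ false
  zero≢suc i = trans (isYes≗does (zero ≟ suc i)) (dec-false (zero ≟ suc i) (λ ()))
count-≟ {suc n} (suc x) = trans (count-cong suc≟suc) (count-≟ x)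
  where
  suc≟suc : ∀ i → ⌊ suc x ≟ suc i ⌋ ≡ ⌊ x ≟ i ⌋
  suc≟suc i with x ≟ i
  ... | yes _ = refl
  ... | no  _ = refl

count-∨-disjoint : ∀ {n} (P Q : Fin n → Bool) → (∀ i → P i ≡ true → Q i ≡ false) →
                   count (λ i → P i ∨ Q i) ≡ count P ℕ.+ count Q
count-∨-disjoint {zero} P Q _ = refl
count-∨-disjoint {suc n} P Q disjoint with P zero in P0 | Q zero in Q0
... | true  | true  = ⊥-elim (true≢false (trans (sym Q0) (disjoint zero P0)))
... | true  | false = cong suc rest
  where rest = count-∨-disjoint (λ i → P (suc i)) (λ i → Q (suc i)) (λ i → disjoint (suc i))
... | false | true  = trans (cong suc rest) (sym (ℕP.+-suc (count (λ i → P (suc i))) _))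
  where rest = count-∨-disjoint (λ i → P (suc i)) (λ i → Q (suc i)) (λ i → disjoint (suc i))
... | false | false = count-∨-disjoint (λ i → P (suc i)) (λ i → Q (suc i)) (λ i → disjoint (suc i))

count-positive : ∀ {n} (P : Fin n → Bool) i → P i ≡ true → 1 ≤ count P
count-positive P zero    P0 rewrite P0 = s≤s z≤n
count-positive P (suc i) Pi =
  ℕP.≤-trans (count-positive (λ j → P (suc j)) i Pi) (ℕP.m≤n+m _ (if P zero then 1 else 0))

count≡∑ : ∀ {n} (P : Fin n → Bool) → count P ≡ ℕΣ.sum (λ i → if P i then 1 else 0)
count≡∑ {zero}  P = refl
count≡∑ {suc n} P = cong ((if P zero then 1 else 0) ℕ.+_) (count≡∑ (λ i → P (suc i)))

∑-if : ∀ {n} (P : Fin n → Bool) m → ℕΣ.sum (λ i → if P i then m else 0) ≡ count P ℕ.* m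
∑-if {zero}  P m = refl
∑-if {suc n} P m with P zero
... | true  = cong (m ℕ.+_) (∑-if (λ i → P (suc i)) m)
... | false = ∑-if (λ i → P (suc i)) m

double-counting : ∀ {n} (P Q : Fin n → Bool) (A : Fin n → Fin n → Bool) → (∀ y z → A y z ≡ A z y) →
  ∀ β γ → (∀ y → P y ≡ true → count (λ z → Q z ∧ A y z) ≡ β) →
          (∀ z → Q z ≡ true → count (λ y → P y ∧ A z y) ≡ γ) →
  count P ℕ.* β ≡ count Q ℕ.* γ
double-counting {n} P Q A A-sym β γ P-degree Q-degree = begin
  count P ℕ.* β                           ≡⟨ sym (∑-if P β) ⟩
  ℕΣ.sum (λ y → if P y then β else 0)     ≡⟨ ℕΣ.sum-cong-≗ by-P ⟩
  ℕΣ.sum (λ y → ℕΣ.sum (λ z → edge y z))  ≡⟨ ℕΣ.∑-comm edge ⟩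
  ℕΣ.sum (λ z → ℕΣ.sum (λ y → edge y z))  ≡⟨ ℕΣ.sum-cong-≗ by-Q ⟩
  ℕΣ.sum (λ z → if Q z then γ else 0)     ≡⟨ ∑-if Q γ ⟩
  count Q ℕ.* γ                           ∎
  where
  edge : Fin n → Fin n → ℕ
  edge y z = if P y ∧ (Q z ∧ A y z) then 1 else 0
  by-P : ∀ y → (if P y then β else 0) ≡ ℕΣ.sum (λ z → edge y z)
  by-P y with P y in Py
  ... | true  = trans (sym (P-degree y Py)) (count≡∑ (λ z → Q z ∧ A y z))
  ... | false = trans (sym (count-false n)) (count≡∑ {n} _)
  by-Q : ∀ z → ℕΣ.sum (λ y → edge y z) ≡ (if Q z then γ else 0)
  by-Q z with Q z in Qz
  ... | true  = trans (ℕΣ.sum-cong-≗ {n} (λ y → cong (λ e → if P y ∧ e then 1 else 0) (A-sym y z)))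
                      (trans (sym (count≡∑ {n} _)) (Q-degree z Qz))
  ... | false = trans (ℕΣ.sum-cong-≗ {n} (λ y → cong (λ e → if e then 1 else 0) (∧-zeroʳ (P y))))
                      (trans (sym (count≡∑ {n} (λ _ → false))) (count-false n))

sumFin-cong : ∀ {n} {f g : Fin n → ℚ} → (∀ i → f i ≡ g i) → sumFin f ≡ sumFin g
sumFin-cong {zero}  f≗g = refl
sumFin-cong {suc n} f≗g = cong₂ _+_ (f≗g zero) (sumFin-cong (λ i → f≗g (suc i)))

sumFin-+ : ∀ {n} (f g : Fin n → ℚ) → sumFin (λ i → f i + g i) ≡ sumFin f + sumFin g
sumFin-+ {zero}  f g = refl
sumFin-+ {suc n} f g rewrite sumFin-+ (λ i → f (suc i)) (λ i → g (suc i)) =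
  solve 4 (λ a b c d → a :+ b :+ (c :+ d) := a :+ c :+ (b :+ d)) refl
    (f zero) (g zero) (sumFin (λ i → f (suc i))) (sumFin (λ i → g (suc i)))

sumFin-- : ∀ {n} (f g : Fin n → ℚ) → sumFin (λ i → f i - g i) ≡ sumFin f - sumFin g
sumFin-- {zero}  f g = refl
sumFin-- {suc n} f g rewrite sumFin-- (λ i → f (suc i)) (λ i → g (suc i)) =
  solve 4 (λ a b c d → a :- b :+ (c :- d) := a :+ c :- (b :+ d)) refl
    (f zero) (g zero) (sumFin (λ i → f (suc i))) (sumFin (λ i → g (suc i)))

sumFin-if : ∀ {n} (P : Fin n → Bool) a → sumFin (λ i → if P i then a else 0ℚ) ≡ ℕtoℚ (count P) * a
sumFin-if {zero}  P a = sym (ℚP.*-zeroˡ a)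
sumFin-if {suc n} P a with P zero
... | true  rewrite sumFin-if (λ i → P (suc i)) a | ℕtoℚ-+ 1 (count (λ i → P (suc i))) =
  solve 2 (λ a c → a :+ c :* a := (con 1ℚ :+ c) :* a) refl a (ℕtoℚ (count (λ i → P (suc i))))
... | false rewrite sumFin-if (λ i → P (suc i)) a = ℚP.+-identityˡ _

sumFin-nonneg : ∀ {n} (f : Fin n → ℚ) → (∀ i → 0ℚ ℚ.≤ f i) → 0ℚ ℚ.≤ sumFin f
sumFin-nonneg {zero}  f f≥0 = ℚP.≤-refl
sumFin-nonneg {suc n} f f≥0 = subst (ℚ._≤ sumFin f) (ℚP.+-identityʳ 0ℚ)
  (ℚP.+-mono-≤ (f≥0 zero) (sumFin-nonneg (λ i → f (suc i)) (λ i → f≥0 (suc i))))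

sumFin-nonneg≡0 : ∀ {n} (f : Fin n → ℚ) → (∀ i → 0ℚ ℚ.≤ f i) → sumFin f ≡ 0ℚ → ∀ i → f i ≡ 0ℚ
sumFin-nonneg≡0 {suc n} f f≥0 Σf≡0 i with nonneg+nonneg≡0 (f≥0 zero) (sumFin-nonneg _ (λ j → f≥0 (suc j))) Σf≡0
sumFin-nonneg≡0 {suc n} f f≥0 Σf≡0 zero    | f0≡0 , _    = f0≡0
sumFin-nonneg≡0 {suc n} f f≥0 Σf≡0 (suc i) | _    , rest = sumFin-nonneg≡0 (λ j → f (suc j)) (λ j → f≥0 (suc j)) rest i

argmax : ∀ {n} (f : Fin n → ℚ) → Fin n → Σ (Fin n) λ m → ∀ y → f y ℚ.≤ f m
argmax {suc zero}    f _ = zero , λ { zero → ℚP.≤-refl }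
argmax {suc (suc n)} f _ with argmax (λ i → f (suc i)) zero
... | m , max with ℚP.≤-total (f zero) (f (suc m))
...   | inj₁ f0≤ = suc m , λ { zero → f0≤ ; (suc y) → max y }
...   | inj₂ ≤f0 = zero  , λ { zero → ℚP.≤-refl ; (suc y) → ℚP.≤-trans (max y) ≤f0 }

sumTo-cong : ∀ m (f g : ℕ → ℚ) → (∀ j → j < m → f j ≡ g j) → sumTo m f ≡ sumTo m g
sumTo-cong zero    f g f≗g = refl
sumTo-cong (suc m) f g f≗g = cong₂ _+_ (sumTo-cong m f g (λ j j<m → f≗g j (ℕP.m<n⇒m<1+n j<m))) (f≗g m ℕP.≤-refl)

sumℕ-mono : ∀ (f : ℕ → ℕ) {i j} → i ≤ j → sumℕ i f ≤ sumℕ j f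
sumℕ-mono f {j = zero}  z≤n = ℕP.≤-refl
sumℕ-mono f {j = suc j} i≤ with ℕP.m≤n⇒m<n∨m≡n i≤
... | inj₂ refl     = ℕP.≤-refl
... | inj₁ (s≤s i≤j) = ℕP.≤-trans (sumℕ-mono f i≤j) (ℕP.m≤m+n _ _)

-- Distances in a graph

module _ {n : ℕ} (G : Graph n) where

  ball-suc : ∀ x m y → ball G x m y ≡ true → ball G x (suc m) y ≡ true
  ball-suc x m y bm = cong (_∨ anyFin (λ z → ball G x m z ∧ adj G z y)) bm

  ball-mono : ∀ x {m} m' y → m ≤ m' → ball G x m y ≡ true → ball G x m' y ≡ true
  ball-mono x zero     y z≤n bm = bm
  ball-mono x (suc m') y m≤ bm with ℕP.m≤n⇒m<n∨m≡n m≤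
  ... | inj₂ refl       = bm
  ... | inj₁ (s≤s m≤m') = ball-suc x m' y (ball-mono x m' y m≤m' bm)

  ball-adj : ∀ x m y z → ball G x m y ≡ true → adj G y z ≡ true → ball G x (suc m) z ≡ true
  ball-adj x m y z bm yz =
    trans (cong (ball G x m z ∨_) (anyFin-intro (λ w → ball G x m w ∧ adj G w z) y (cong₂ _∧_ bm yz)))
          (∨-zeroʳ (ball G x m z))

  sphere⇒ball : ∀ x m y → Dist G x y m → ball G x m y ≡ true
  sphere⇒ball x zero    y d = d
  sphere⇒ball x (suc m) y d = ∧-conicalˡ _ _ d

  sphere-suc⇒¬ball : ∀ x m y → Dist G x y (suc m) → ball G x m y ≡ false
  sphere-suc⇒¬ball x m y d =
    trans (sym (not-involutive (ball G x m y))) (cong not (∧-conicalʳ (ball G x (suc m) y) _ d))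

  ball⇒≤ : ∀ x m d y → ball G x m y ≡ true → Dist G x y d → d ≤ m
  ball⇒≤ x m zero    y _  _    = z≤n
  ball⇒≤ x m (suc d) y bm dist with suc d ℕ.≤? m
  ... | yes d<m = d<m
  ... | no  d≮m = ⊥-elim (true≢false (trans (sym (ball-mono x d y (ℕP.≤-pred (ℕP.≰⇒> d≮m)) bm))
                                                 (sphere-suc⇒¬ball x d y dist)))

  dist-unique : ∀ x y d d' → Dist G x y d → Dist G x y d' → d ≡ d'
  dist-unique x y d d' dd dd' =
    ℕP.≤-antisym (ball⇒≤ x d' d y (sphere⇒ball x d' y dd') dd) (ball⇒≤ x d d' y (sphere⇒ball x d y dd) dd')

  sphere-false : ∀ x y d m → Dist G x y d → m ≢ d → sphere G x m y ≡ false
  sphere-false x y d m dd m≢d = ¬-not (λ dm → m≢d (dist-unique x y m d dm dd))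

  dist-adj-≤ : ∀ x y z d e → Dist G x y d → adj G y z ≡ true → Dist G x z e → e ≤ suc d
  dist-adj-≤ x y z d e dy yz dz = ball⇒≤ x (suc d) e z (ball-adj x d y z (sphere⇒ball x d y dy) yz) dz

  sphere-predecessor : ∀ x m y → Dist G x y (suc m) → ∃ λ z → Dist G x z m × adj G z y ≡ true
  sphere-predecessor x m y dy with ∨-true (ball G x m y) (sphere⇒ball x (suc m) y dy)
  ... | inj₁ bm  = ⊥-elim (true≢false (trans (sym bm) (sphere-suc⇒¬ball x m y dy)))
  ... | inj₂ any with anyFin-witness (λ w → ball G x m w ∧ adj G w y) any
  ...   | z , bz∧zy = z , on-sphere m dy (∧-conicalˡ _ _ bz∧zy) , zy
    where
    zy = ∧-conicalʳ (ball G x m z) _ bz∧zy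
    on-sphere : ∀ k → Dist G x y (suc k) → ball G x k z ≡ true → Dist G x z k
    on-sphere zero     _   bz = bz
    on-sphere (suc k) dyk bz = cong₂ _∧_ bz (cong not (¬-not {ball G x k z} (λ bk →
      true≢false (trans (sym (ball-adj x k z y bk zy)) (sphere-suc⇒¬ball x (suc k) y dyk)))))

  sphere-inhabited : ∀ x y m → Dist G x y m → ∀ i → i ≤ m → ∃ λ z → Dist G x z i
  sphere-inhabited x y zero    dy i z≤n = y , dy
  sphere-inhabited x y (suc m) dy i i≤ with ℕP.m≤n⇒m<n∨m≡n i≤
  ... | inj₂ refl      = y , dy
  ... | inj₁ (s≤s i≤m) = let (z , dz , _) = sphere-predecessor x m y dy in sphere-inhabited x z m dz i i≤m

  ball-suc≡ball∨sphere : ∀ x m y → ball G x (suc m) y ≡ ball G x m y ∨ sphere G x (suc m) y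
  ball-suc≡ball∨sphere x m y with ball G x m y
  ... | true  = refl
  ... | false = sym (∧-identityʳ _)

  count-ball : ∀ x m → count (ball G x m) ≡ BB G x m
  count-ball x zero    = refl
  count-ball x (suc m) = begin
    count (ball G x (suc m))                          ≡⟨ count-cong (ball-suc≡ball∨sphere x m) ⟩
    count (λ y → ball G x m y ∨ sphere G x (suc m) y) ≡⟨ count-∨-disjoint _ _ disjoint ⟩
    count (ball G x m) ℕ.+ kk G x (suc m)             ≡⟨ cong (ℕ._+ kk G x (suc m)) (count-ball x m) ⟩
    BB G x m ℕ.+ kk G x (suc m)                       ∎
    where
    disjoint : ∀ y → ball G x m y ≡ true → sphere G x (suc m) y ≡ false
    disjoint y bm = ¬-not (λ dy → true≢false (trans (sym bm) (sphere-suc⇒¬ball x m y dy)))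

  kk-zero : ∀ x → kk G x 0 ≡ 1
  kk-zero = count-≟

  sphere-one≡adj : ∀ x z → sphere G x 1 z ≡ adj G x z
  sphere-one≡adj x z with adj G x z in xz
  ... | true  = cong₂ _∧_ (ball-adj x 0 x z (≟-refl x) xz) (cong not (¬-not x≢z))
    where
    x≢z : ⌊ x ≟ z ⌋ ≢ true
    x≢z x≟z = true≢false (trans (sym xz) (trans (cong (adj G x) (sym (≟⇒≡ x≟z))) (irrefl G x)))
  ... | false = ¬-not λ dz → let (w , dw , wz) = sphere-predecessor x 0 z dz in
                  true≢false (trans (sym wz) (trans (cong (λ v → adj G v z) (sym (≟⇒≡ dw))) xz))

  -- Harmonic functions

  laplacian-distrib-sub : ∀ (f g : Fin n → ℚ) z →
                          laplacian G (λ y → f y - g y) z ≡ laplacian G f z - laplacian G g z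
  laplacian-distrib-sub f g z = trans (sumFin-cong edge-term)
    (sumFin-- (λ y → if adj G z y then f z - f y else 0ℚ) (λ y → if adj G z y then g z - g y else 0ℚ))
    where
    edge-term : ∀ y → (if adj G z y then (f z - g z) - (f y - g y) else 0ℚ)
                    ≡ (if adj G z y then f z - f y else 0ℚ) - (if adj G z y then g z - g y else 0ℚ)
    edge-term y with adj G z y
    ... | true  = solve 4 (λ a b c d → (a :- b) :- (c :- d) := (a :- c) :- (b :- d)) refl (f z) (g z) (f y) (g y)
    ... | false = refl

  -- Maximum principle: at a maximum z of f the Laplacian is a sum of nonnegative terms f z − f y,
  -- so f is maximal at every neighbour of z, and connectedness spreads this to all vertices.
  harmonic⇒constant : Connected G → (f : Fin n → ℚ) → (∀ z → laplacian G f z ≡ 0ℚ) → ∀ x y → f y ≡ f x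
  harmonic⇒constant connected f harmonic x y = trans (≡max y) (sym (≡max x))
    where
    m = proj₁ (argmax f x)
    ≤max = proj₂ (argmax f x)
    neighbour-max : ∀ {z y} → f z ≡ f m → adj G z y ≡ true → f y ≡ f m
    neighbour-max {z} {y} fz≡ zy = trans (q-p≡0⇒p≡q (f y) (f z) term≡0) fz≡
      where
      term≥0 : ∀ y' → 0ℚ ℚ.≤ (if adj G z y' then f z - f y' else 0ℚ)
      term≥0 y' with adj G z y'
      ... | true  = p≤q⇒0≤q-p (subst (f y' ℚ.≤_) (sym fz≡) (≤max y'))
      ... | false = ℚP.≤-refl
      term≡0 : f z - f y ≡ 0ℚ
      term≡0 = subst (λ b → (if b then f z - f y else 0ℚ) ≡ 0ℚ) zy (sumFin-nonneg≡0 _ term≥0 (harmonic z) y)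
    ball-max : ∀ r y → ball G m r y ≡ true → f y ≡ f m
    ball-max zero    y bm = cong f (sym (≟⇒≡ bm))
    ball-max (suc r) y bm with ∨-true (ball G m r y) bm
    ... | inj₁ inner = ball-max r y inner
    ... | inj₂ any with anyFin-witness (λ w → ball G m r w ∧ adj G w y) any
    ...   | z , bz∧zy = neighbour-max (ball-max r z (∧-conicalˡ _ _ bz∧zy)) (∧-conicalʳ _ _ bz∧zy)
    ≡max : ∀ y → f y ≡ f m
    ≡max y = let (r , dy) = connected m y in ball-max r y (sphere⇒ball m r y dy)

  laplacian-injective : Connected G → (u v : Fin n → ℚ) → (∀ z → laplacian G u z ≡ laplacian G v z) →
                        ∀ x → u x ≡ v x → ∀ y → u y ≡ v y
  laplacian-injective connected u v Lu≡Lv x ux≡vx y =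
    sym (q-p≡0⇒p≡q (v y) (u y) (trans (harmonic⇒constant connected (λ w → u w - v w) harmonic x y)
                              (trans (cong (_- v x) ux≡vx) (ℚP.+-inverseʳ (v x)))))
    where
    harmonic : ∀ z → laplacian G (λ w → u w - v w) z ≡ 0ℚ
    harmonic z = trans (laplacian-distrib-sub u v z)
                       (trans (cong (_- laplacian G v z) (Lu≡Lv z)) (ℚP.+-inverseʳ (laplacian G v z)))

-- The Laplacian of a radial function

data Near (i : ℕ) : ℕ → Set where
  below : Near i i
  level : Near i (suc i)
  above : Near i (suc (suc i))

near : ∀ i e → i ≤ e → e ≤ suc (suc i) → Near i e
near zero    zero                _       _                 = below
near zero    (suc zero)          _       _                 = level
near zero    (suc (suc zero))    _       _                 = above
near zero    (suc (suc (suc e))) _       (s≤s (s≤s ()))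
near (suc i) (suc e)             (s≤s p) (s≤s q) with near i e p q
... | below = below
... | level = level
... | above = above

module Radial {n : ℕ} (G : Graph n) (connected : Connected G) (x : Fin n) where

  dist : Fin n → ℕ
  dist y = proj₁ (connected x y)

  dist-spec : ∀ y → Dist G x y (dist y)
  dist-spec y = proj₂ (connected x y)

  dist-≡ : ∀ y m → Dist G x y m → dist y ≡ m
  dist-≡ y m dm = dist-unique G x y (dist y) m (dist-spec y) dm

  laplacian-radial-centre : (q : ℕ → ℚ) →
    laplacian G (λ y → q (dist y)) x ≡ ℕtoℚ (count (λ y → sphere G x 1 y ∧ adj G x y)) * (q 0 - q 1)
  laplacian-radial-centre q =
    trans (sumFin-cong edge-term) (sumFin-if (λ y → sphere G x 1 y ∧ adj G x y) (q 0 - q 1))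
    where
    edge-term : ∀ y → (if adj G x y then q (dist x) - q (dist y) else 0ℚ)
                    ≡ (if sphere G x 1 y ∧ adj G x y then q 0 - q 1 else 0ℚ)
    edge-term y rewrite sphere-one≡adj G x y | ∧-idem (adj G x y) with adj G x y in xy
    ... | true  = cong₂ (λ a b → q a - q b) (dist-≡ x 0 (≟-refl x))
                                             (dist-≡ y 1 (trans (sphere-one≡adj G x y) xy))
    ... | false = refl

  laplacian-radial-suc : (q : ℕ → ℚ) → ∀ z i → Dist G x z (suc i) →
    laplacian G (λ y → q (dist y)) z
      ≡ ℕtoℚ (count (λ y → sphere G x i y ∧ adj G z y)) * (q (suc i) - q i)
        + ℕtoℚ (count (λ y → sphere G x (suc (suc i)) y ∧ adj G z y)) * (q (suc i) - q (suc (suc i)))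
  laplacian-radial-suc q z i dz =
    trans (sumFin-cong edge-term)
          (trans (sumFin-+ inward outward)
                 (cong₂ _+_ (sumFin-if (λ y → sphere G x i y ∧ adj G z y) (q (suc i) - q i))
                            (sumFin-if (λ y → sphere G x (suc (suc i)) y ∧ adj G z y) (q (suc i) - q (suc (suc i))))))
    where
    inward outward : Fin n → ℚ
    inward  y = if sphere G x i y ∧ adj G z y then q (suc i) - q i else 0ℚ
    outward y = if sphere G x (suc (suc i)) y ∧ adj G z y then q (suc i) - q (suc (suc i)) else 0ℚ

    near-neighbour : ∀ y → adj G z y ≡ true → Near i (dist y)
    near-neighbour y zy = near i (dist y)
      (ℕP.≤-pred (dist-adj-≤ G x y z (dist y) (suc i) (dist-spec y) (trans (symm G y z) zy) dz))
      (dist-adj-≤ G x z y (suc i) (dist y) dz zy (dist-spec y))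

    i<2+i : i < suc (suc i)
    i<2+i = ℕP.m<n⇒m<1+n (ℕP.n<1+n i)

    edge-term : ∀ y → (if adj G z y then q (dist z) - q (dist y) else 0ℚ)
      ≡ (if sphere G x i y ∧ adj G z y then q (suc i) - q i else 0ℚ)
        + (if sphere G x (suc (suc i)) y ∧ adj G z y then q (suc i) - q (suc (suc i)) else 0ℚ)
    edge-term y rewrite dist-≡ z (suc i) dz with adj G z y in zy
    ... | false rewrite ∧-zeroʳ (sphere G x i y) | ∧-zeroʳ (sphere G x (suc (suc i)) y) =
      sym (ℚP.+-identityʳ 0ℚ)
    ... | true with dist y | dist-spec y | near-neighbour y zy
    ...   | _ | dy | below rewrite dy | sphere-false G x y i (suc (suc i)) dy (ℕP.>⇒≢ i<2+i) =
      sym (ℚP.+-identityʳ _)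
    ...   | _ | dy | level rewrite sphere-false G x y (suc i) i dy (ℕP.<⇒≢ (ℕP.n<1+n i))
                             | sphere-false G x y (suc i) (suc (suc i)) dy (ℕP.>⇒≢ (ℕP.n<1+n (suc i))) =
      trans (ℚP.+-inverseʳ (q (suc i))) (sym (ℚP.+-identityʳ 0ℚ))
    ...   | _ | dy | above rewrite dy | sphere-false G x y (suc (suc i)) i dy (ℕP.<⇒≢ i<2+i) =
      sym (ℚP.+-identityˡ _)

-- Distance-biregular graphs

≢⇒≡flip : ∀ (u v : Fin 2) → u ≢ v → v ≡ flip u
≢⇒≡flip zero       zero       u≢v = ⊥-elim (u≢v refl)
≢⇒≡flip zero       (suc zero) _   = refl
≢⇒≡flip (suc zero) zero       _   = refl
≢⇒≡flip (suc zero) (suc zero) u≢v = ⊥-elim (u≢v refl)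

module DistanceBiregularSide {n : ℕ} {G : Graph n} {side : Fin n → Fin 2} {k : Fin 2 → ℕ}
  {c b : Fin 2 → ℕ → ℕ} {D : Fin 2 → ℕ} (dbr : DistanceBiregular G side k c b D) (ℓ : Fin 2) where

  connected : Connected G
  connected = proj₁ dbr

  stable : ∀ x y → adj G x y ≡ true → side x ≢ side y
  stable = proj₁ (proj₁ (proj₂ dbr))

  neighbour-side : ∀ x y → adj G x y ≡ true → side y ≡ flip (side x)
  neighbour-side x y xy = ≢⇒≡flip (side x) (side y) (stable x y xy)

  regular : ∀ x → degree G x ≡ k (side x)
  regular = proj₂ (proj₁ (proj₂ dbr))

  dist≤D : ∀ x y m → side x ≡ ℓ → Dist G x y m → m ≤ D ℓ
  dist≤D = proj₁ (proj₂ (proj₂ (proj₂ dbr)) ℓ)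

  c-count : ∀ x y i → side x ≡ ℓ → Dist G x y (suc i) →
            count (λ z → sphere G x i z ∧ adj G y z) ≡ c ℓ (suc i)
  c-count x y i refl dy = proj₁ (proj₁ (proj₂ (proj₂ dbr)) x y (suc i) dy)

  b-count : ∀ x y i → side x ≡ ℓ → Dist G x y i →
            count (λ z → sphere G x (suc i) z ∧ adj G y z) ≡ b ℓ i
  b-count x y i refl dy = proj₂ (proj₁ (proj₂ (proj₂ dbr)) x y i dy)

  kk-b≡kk-c : ∀ x j → side x ≡ ℓ → kk G x j ℕ.* b ℓ j ≡ kk G x (suc j) ℕ.* c ℓ (suc j)
  kk-b≡kk-c x j side-x =
    double-counting (sphere G x j) (sphere G x (suc j)) (adj G) (symm G) (b ℓ j) (c ℓ (suc j))
                    (λ y dy → b-count x y j side-x dy) (λ z dz → c-count x z j side-x dz)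

  extremal-pair : ∃ λ x → ∃ λ y → side x ≡ ℓ × Dist G x y (D ℓ)
  extremal-pair = proj₂ (proj₂ (proj₂ (proj₂ dbr)) ℓ)

  x₀ : Fin n
  x₀ = proj₁ extremal-pair

  side-x₀ : side x₀ ≡ ℓ
  side-x₀ = proj₁ (proj₂ (proj₂ extremal-pair))

  sphere₀-inhabited : ∀ i → i ≤ D ℓ → ∃ λ y → Dist G x₀ y i
  sphere₀-inhabited =
    sphere-inhabited G x₀ (proj₁ (proj₂ extremal-pair)) (D ℓ) (proj₂ (proj₂ (proj₂ extremal-pair)))

  c-positive : ∀ i → suc i ≤ D ℓ → 1 ≤ c ℓ (suc i)
  c-positive i i<D = let (y , dy) = sphere₀-inhabited (suc i) i<D
                         (z , dz , zy) = sphere-predecessor G x₀ i y dy in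
    subst (1 ≤_) (c-count x₀ y i side-x₀ dy) (count-positive _ z (cong₂ _∧_ dz (trans (symm G y z) zy)))

  b-positive : ∀ i → suc i ≤ D ℓ → 1 ≤ b ℓ i
  b-positive i i<D = let (y , dy) = sphere₀-inhabited (suc i) i<D
                         (z , dz , zy) = sphere-predecessor G x₀ i y dy in
    subst (1 ≤_) (b-count x₀ z i side-x₀ dz) (count-positive _ y (cong₂ _∧_ dy zy))

  K : ℕ → ℕ
  K = kk G x₀

  B : ℕ → ℕ
  B = BB G x₀

  K-positive : ∀ i → i ≤ D ℓ → 1 ≤ K i
  K-positive i i≤D = let (y , dy) = sphere₀-inhabited i i≤D in count-positive _ y dy

  kk≡K : ∀ x → side x ≡ ℓ → ∀ i → i ≤ D ℓ → kk G x i ≡ K i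
  kk≡K x side-x zero    _   = trans (kk-zero G x) (sym (kk-zero G x₀))
  kk≡K x side-x (suc i) i<D = ℕP.*-cancelʳ-≡ _ _ (c ℓ (suc i)) {{ℕ.>-nonZero (c-positive i i<D)}} (begin
    kk G x (suc i) ℕ.* c ℓ (suc i) ≡⟨ sym (kk-b≡kk-c x i side-x) ⟩
    kk G x i ℕ.* b ℓ i             ≡⟨ cong (ℕ._* b ℓ i) (kk≡K x side-x i (ℕP.<⇒≤ i<D)) ⟩
    K i ℕ.* b ℓ i                  ≡⟨ kk-b≡kk-c x₀ i side-x₀ ⟩
    K (suc i) ℕ.* c ℓ (suc i)      ∎)

  BB≡B : ∀ x → side x ≡ ℓ → ∀ i → i ≤ D ℓ → BB G x i ≡ B i
  BB≡B x side-x zero    i≤D = kk≡K x side-x zero i≤D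
  BB≡B x side-x (suc i) i<D = cong₂ ℕ._+_ (BB≡B x side-x i (ℕP.<⇒≤ i<D)) (kk≡K x side-x (suc i) i<D)

  B-D≡n : B (D ℓ) ≡ n
  B-D≡n = begin
    B (D ℓ)               ≡⟨ sym (count-ball G x₀ (D ℓ)) ⟩
    count (ball G x₀ (D ℓ)) ≡⟨ count-cong within-D ⟩
    count {n} (λ _ → true)  ≡⟨ count-true n ⟩
    n                       ∎
    where
    open Radial G connected x₀ using (dist; dist-spec)
    within-D : ∀ y → ball G x₀ (D ℓ) y ≡ true
    within-D y = ball-mono G x₀ (D ℓ) y (dist≤D x₀ y (dist y) side-x₀ (dist-spec y))
                                        (sphere⇒ball G x₀ (dist y) y (dist-spec y))

  B≤n : ∀ j → j ≤ D ℓ → B j ≤ n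
  B≤n j j≤D = subst (B j ≤_) B-D≡n (sumℕ-mono K j≤D)

  B<n : ∀ j → suc j ≤ D ℓ → B j < n
  B<n j j<D = ℕP.<-≤-trans (ℕP.m<m+n (B j) (K-positive (suc j) j<D)) (B≤n (suc j) j<D)

  -- q is the paper's q_{ℓ,m}, computed from the spheres around x₀; by kk≡K and BB≡B any x ∈ V_ℓ gives the same.
  beyond : ℕ → ℚ
  beyond j = ℕtoℚ n - ℕtoℚ (B j)

  step : ℕ → ℚ
  step j = beyond j ÷ℕ (K j ℕ.* b ℓ j)

  q : ℕ → ℚ
  q m = sumTo m step

  step-positive : ∀ j → suc j ≤ D ℓ → 0ℚ ℚ.< step j
  step-positive j j<D =
    subst (λ v → 0ℚ ℚ.< v ÷ℕ (K j ℕ.* b ℓ j)) (ℕtoℚ-∸ n (B j) (ℕP.<⇒≤ (B<n j j<D)))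
      (ℕtoℚ-÷ℕ-positive (n ∸ B j) (K j ℕ.* b ℓ j) (ℕP.m<n⇒0<n∸m (B<n j j<D))
                        (ℕP.*-mono-≤ (K-positive j (ℕP.<⇒≤ j<D)) (b-positive j j<D)))

  q-increasing : ∀ i j → i < j → j ≤ D ℓ → q i ℚ.< q j
  q-increasing i (suc j) (s≤s i≤j) j<D with ℕP.m≤n⇒m<n∨m≡n i≤j
  ... | inj₂ refl = p<p+q (q i) (step i) (step-positive i j<D)
  ... | inj₁ i<j  = ℚP.<-trans (q-increasing i j i<j (ℕP.<⇒≤ j<D))
                               (p<p+q (q j) (step j) (step-positive j j<D))

  q-injective : ∀ i j → i ≤ D ℓ → j ≤ D ℓ → q i ≡ q j → i ≡ j
  q-injective i j i≤D j≤D qi≡qj with ℕP.<-cmp i j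
  ... | tri< i<j _ _ = ⊥-elim (ℚP.<-irrefl qi≡qj (q-increasing i j i<j j≤D))
  ... | tri≈ _ i≡j _ = i≡j
  ... | tri> _ _ j<i = ⊥-elim (ℚP.<-irrefl (sym qi≡qj) (q-increasing j i j<i i≤D))

  q[1+m]-q[m]≡step : ∀ m → q (suc m) - q m ≡ step m
  q[1+m]-q[m]≡step m = solve 2 (λ s t → s :+ t :- s := t) refl (q m) (step m)

  q[m]-q[1+m]≡-step : ∀ m → q m - q (suc m) ≡ - step m
  q[m]-q[1+m]≡-step m = solve 2 (λ s t → s :- (s :+ t) := :- t) refl (q m) (step m)

  beyond-suc : ∀ i → beyond (suc i) ≡ beyond i - ℕtoℚ (K (suc i))
  beyond-suc i = trans (cong (λ v → ℕtoℚ n - v) (ℕtoℚ-+ (B i) (K (suc i))))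
    (solve 3 (λ n b k → n :- (b :+ k) := n :- b :- k) refl (ℕtoℚ n) (ℕtoℚ (B i)) (ℕtoℚ (K (suc i))))

  b*step : ∀ j → j ≤ D ℓ → ℕtoℚ (b ℓ j) * step j ≡ beyond j ÷ℕ K j
  b*step j j≤D with b ℓ j in b≡
  ... | suc b' = ℕtoℚ-*-÷ℕ-* (beyond j) (K j) (suc b') (K-positive j j≤D) (s≤s z≤n)
  -- b_{ℓ,j} = 0 forces j = D_ℓ, and no vertex lies beyond distance D_ℓ.
  ... | zero   = trans (ℚP.*-zeroˡ (beyond j ÷ℕ (K j ℕ.* 0)))
                       (sym (trans (cong (_÷ℕ K j) beyond≡0) (÷ℕ-zeroˡ (K j))))
    where
    j≡D : j ≡ D ℓ
    j≡D with ℕP.m≤n⇒m<n∨m≡n j≤D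
    ... | inj₂ j≡D = j≡D
    ... | inj₁ j<D with subst (1 ≤_) b≡ (b-positive j j<D)
    ...   | ()
    beyond≡0 : beyond j ≡ 0ℚ
    beyond≡0 = trans (cong (λ v → ℕtoℚ n - ℕtoℚ v) (trans (cong B j≡D) B-D≡n)) (ℚP.+-inverseʳ (ℕtoℚ n))

  c*step : ∀ i → suc i ≤ D ℓ → ℕtoℚ (c ℓ (suc i)) * step i ≡ beyond i ÷ℕ K (suc i)
  c*step i i<D = trans (cong (λ v → ℕtoℚ (c ℓ (suc i)) * (beyond i ÷ℕ v)) (kk-b≡kk-c x₀ i side-x₀))
                       (ℕtoℚ-*-÷ℕ-* (beyond i) (K (suc i)) (c ℓ (suc i)) (K-positive (suc i) i<D) (c-positive i i<D))

  module _ (x : Fin n) (side-x : side x ≡ ℓ) where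
    open Radial G connected x

    laplacian-centre : laplacian G (λ y → q (dist y)) x ≡ 1ℚ - ℕtoℚ n
    laplacian-centre = begin
      laplacian G (λ y → q (dist y)) x
        ≡⟨ laplacian-radial-centre q ⟩
      ℕtoℚ (count (λ y → sphere G x 1 y ∧ adj G x y)) * (q 0 - q 1)
        ≡⟨ cong₂ (λ u v → ℕtoℚ u * v) (b-count x x 0 side-x (≟-refl x)) (q[m]-q[1+m]≡-step 0) ⟩
      ℕtoℚ (b ℓ 0) * - step 0
        ≡⟨ sym (ℚP.neg-distribʳ-* (ℕtoℚ (b ℓ 0)) (step 0)) ⟩
      - (ℕtoℚ (b ℓ 0) * step 0)
        ≡⟨ cong -_ (b*step 0 z≤n) ⟩
      - (beyond 0 ÷ℕ K 0)
        ≡⟨ cong (λ v → - ((ℕtoℚ n - ℕtoℚ v) ÷ℕ v)) (kk-zero G x₀) ⟩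
      - ((ℕtoℚ n - 1ℚ) ÷ℕ 1)
        ≡⟨ cong -_ (÷ℕ-identityʳ (ℕtoℚ n - 1ℚ)) ⟩
      - (ℕtoℚ n - 1ℚ)
        ≡⟨ solve 1 (λ m → :- (m :- con 1ℚ) := con 1ℚ :- m) refl (ℕtoℚ n) ⟩
      1ℚ - ℕtoℚ n
        ∎

    laplacian-off-centre : ∀ z i → Dist G x z (suc i) → laplacian G (λ y → q (dist y)) z ≡ 1ℚ
    laplacian-off-centre z i dz = begin
      laplacian G (λ y → q (dist y)) z
        ≡⟨ laplacian-radial-suc q z i dz ⟩
      ℕtoℚ (count (λ y → sphere G x i y ∧ adj G z y)) * (q (suc i) - q i)
        + ℕtoℚ (count (λ y → sphere G x (suc (suc i)) y ∧ adj G z y)) * (q (suc i) - q (suc (suc i)))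
        ≡⟨ cong₂ (λ u v → ℕtoℚ u * (q (suc i) - q i) + ℕtoℚ v * (q (suc i) - q (suc (suc i))))
                 (c-count x z i side-x dz) (b-count x z (suc i) side-x dz) ⟩
      ℕtoℚ γ * (q (suc i) - q i) + ℕtoℚ β * (q (suc i) - q (suc (suc i)))
        ≡⟨ cong₂ (λ u v → ℕtoℚ γ * u + ℕtoℚ β * v) (q[1+m]-q[m]≡step i) (q[m]-q[1+m]≡-step (suc i)) ⟩
      ℕtoℚ γ * step i + ℕtoℚ β * - step (suc i)
        ≡⟨ solve 4 (λ g s h t → g :* s :+ h :* (:- t) := g :* s :- h :* t) refl
                   (ℕtoℚ γ) (step i) (ℕtoℚ β) (step (suc i)) ⟩
      ℕtoℚ γ * step i - ℕtoℚ β * step (suc i)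
        ≡⟨ cong₂ _-_ (c*step i i<D) (b*step (suc i) i<D) ⟩
      beyond i ÷ℕ K (suc i) - beyond (suc i) ÷ℕ K (suc i)
        ≡⟨ cong (λ v → beyond i ÷ℕ K (suc i) - v ÷ℕ K (suc i)) (beyond-suc i) ⟩
      beyond i ÷ℕ K (suc i) - (beyond i - ℕtoℚ (K (suc i))) ÷ℕ K (suc i)
        ≡⟨ ÷ℕ-sub-denominator (beyond i) (K (suc i)) (K-positive (suc i) i<D) ⟩
      1ℚ
        ∎
      where
      γ β : ℕ
      γ = c ℓ (suc i)
      β = b ℓ (suc i)
      i<D : suc i ≤ D ℓ
      i<D = dist≤D x z (suc i) side-x dz

    off-centre : ∀ z i → Dist G x z (suc i) → z ≢ x
    off-centre z i dz refl = ℕP.0≢1+n (dist-unique G x x 0 (suc i) (≟-refl x) dz)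

    laplacian-at-distance : ∀ z m → Dist G x z m →
      laplacian G (λ y → q (dist y)) z ≡ 1ℚ - (if ⌊ z ≟ x ⌋ then ℕtoℚ n else 0ℚ)
    laplacian-at-distance z zero dz with ≟⇒≡ {x = x} {y = z} dz
    ... | refl rewrite ≟-refl x = laplacian-centre
    laplacian-at-distance z (suc i) dz rewrite trans (isYes≗does (z ≟ x)) (dec-false (z ≟ x) (off-centre z i dz)) =
      laplacian-off-centre z i dz

    equilibrium≡q∘dist : (ν : Fin n → ℚ) → IsEquilibrium G x ν → ∀ y → ν y ≡ q (dist y)
    equilibrium≡q∘dist ν (ν-x≡0 , _ , Lν≡) =
      laplacian-injective G connected ν (λ y → q (dist y)) (λ z → trans (Lν≡ z) (sym (laplacian-at-distance z (dist z) (dist-spec z))))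
                          x (trans ν-x≡0 (sym (cong q (dist-≡ x 0 (≟-refl x)))))

    equilibrium⇔dist : (ν : Fin n → ℚ) → IsEquilibrium G x ν → ∀ y m → m ≤ D ℓ → (ν y ≡ q m) ⇔ Dist G x y m
    equilibrium⇔dist ν equilibrium y m m≤D = mk⇔
      (λ νy≡qm → subst (Dist G x y)
        (q-injective (dist y) m (dist≤D x y (dist y) side-x (dist-spec y)) m≤D
                     (trans (sym (equilibrium≡q∘dist ν equilibrium y)) νy≡qm))
        (dist-spec y))
      (λ dm → trans (equilibrium≡q∘dist ν equilibrium y) (cong q (dist-≡ y m dm)))

  q≡∑-kk*b : ∀ x → side x ≡ ℓ → ∀ m → m ≤ D ℓ →
             q m ≡ sumTo m (λ j → (ℕtoℚ n - ℕtoℚ (BB G x j)) ÷ℕ (kk G x j ℕ.* b ℓ j))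
  q≡∑-kk*b x side-x m m≤D = sumTo-cong m step _ λ j j<m →
    let j≤D = ℕP.≤-trans (ℕP.<⇒≤ j<m) m≤D in
    cong₂ (λ β κ → (ℕtoℚ n - ℕtoℚ β) ÷ℕ (κ ℕ.* b ℓ j)) (sym (BB≡B x side-x j j≤D)) (sym (kk≡K x side-x j j≤D))

  q≡∑-kk*c : ∀ x → side x ≡ ℓ → ∀ m → m ≤ D ℓ →
             q m ≡ sumTo m (λ j → (ℕtoℚ n - ℕtoℚ (BB G x j)) ÷ℕ (kk G x (suc j) ℕ.* c ℓ (suc j)))
  q≡∑-kk*c x side-x m m≤D = trans (q≡∑-kk*b x side-x m m≤D) (sumTo-cong m _ _ λ j _ →
    cong (λ v → (ℕtoℚ n - ℕtoℚ (BB G x j)) ÷ℕ v) (kk-b≡kk-c x j side-x))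

  K₁≡k : K 1 ≡ k ℓ
  K₁≡k = trans (count-cong (sphere-one≡adj G x₀)) (trans (regular x₀) (cong k side-x₀))

  b₀≡k : b ℓ 0 ≡ k ℓ
  b₀≡k = begin
    b ℓ 0                                        ≡⟨ sym (b-count x₀ x₀ 0 side-x₀ (≟-refl x₀)) ⟩
    count (λ z → sphere G x₀ 1 z ∧ adj G x₀ z)   ≡⟨ count-cong (λ z → cong (_∧ adj G x₀ z) (sphere-one≡adj G x₀ z)) ⟩
    count (λ z → adj G x₀ z ∧ adj G x₀ z)        ≡⟨ count-cong (λ z → ∧-idem (adj G x₀ z)) ⟩
    degree G x₀                                  ≡⟨ trans (regular x₀) (cong k side-x₀) ⟩
    k ℓ                                          ∎

  b₁≡k̄∸1 : 2 ≤ D ℓ → b ℓ 1 ≡ k (flip ℓ) ∸ 1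
  b₁≡k̄∸1 2≤D = cong (_∸ 1) (sym k̄≡1+b₁)
    where
    open Radial G connected x₀ using (dist; dist-spec)
    y₁ : Fin n
    y₁ = proj₁ (sphere₀-inhabited 1 (ℕP.<⇒≤ 2≤D))
    dy₁ : Dist G x₀ y₁ 1
    dy₁ = proj₂ (sphere₀-inhabited 1 (ℕP.<⇒≤ 2≤D))
    x₀y₁ : adj G x₀ y₁ ≡ true
    x₀y₁ = trans (sym (sphere-one≡adj G x₀ y₁)) dy₁
    side-y₁ : side y₁ ≡ flip ℓ
    side-y₁ = trans (neighbour-side x₀ y₁ x₀y₁) (cong flip side-x₀)
    -- The graph is bipartite, so no neighbour of y₁ is at distance 1 from x₀.
    neighbours : ∀ z → adj G y₁ z ≡ ⌊ x₀ ≟ z ⌋ ∨ (sphere G x₀ 2 z ∧ adj G y₁ z)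
    neighbours z with adj G y₁ z in y₁z
    ... | false = sym (cong₂ _∨_ x₀≢z (∧-zeroʳ (sphere G x₀ 2 z)))
      where
      x₀≢z : ⌊ x₀ ≟ z ⌋ ≡ false
      x₀≢z = ¬-not λ x₀≟z → true≢false (trans (sym (trans (symm G y₁ x₀) x₀y₁))
                                           (trans (cong (adj G y₁) (≟⇒≡ x₀≟z)) y₁z))
    ... | true with dist z | dist-spec z | near 0 (dist z) z≤n (dist-adj-≤ G x₀ y₁ z 1 (dist z) dy₁ y₁z (dist-spec z))
    ...   | _ | dz | below rewrite dz = refl
    ...   | _ | dz | level = ⊥-elim (stable y₁ z y₁z (trans side-y₁ (sym side-z)))
      where
      side-z : side z ≡ flip ℓ
      side-z = trans (neighbour-side x₀ z (trans (sym (sphere-one≡adj G x₀ z)) dz)) (cong flip side-x₀)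
    ...   | _ | dz | above rewrite dz = sym (∨-zeroʳ _)
    disjoint : ∀ z → ⌊ x₀ ≟ z ⌋ ≡ true → (sphere G x₀ 2 z ∧ adj G y₁ z) ≡ false
    disjoint z x₀≟z = cong (_∧ adj G y₁ z) (sphere-false G x₀ z 0 2 x₀≟z (λ ()))
    k̄≡1+b₁ : k (flip ℓ) ≡ suc (b ℓ 1)
    k̄≡1+b₁ = begin
      k (flip ℓ)
        ≡⟨ sym (trans (regular y₁) (cong k side-y₁)) ⟩
      degree G y₁
        ≡⟨ count-cong neighbours ⟩
      count (λ z → ⌊ x₀ ≟ z ⌋ ∨ (sphere G x₀ 2 z ∧ adj G y₁ z))
        ≡⟨ count-∨-disjoint _ _ disjoint ⟩
      count (λ z → ⌊ x₀ ≟ z ⌋) ℕ.+ count (λ z → sphere G x₀ 2 z ∧ adj G y₁ z)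
        ≡⟨ cong₂ ℕ._+_ (count-≟ x₀) (b-count x₀ y₁ 1 side-x₀ dy₁) ⟩
      suc (b ℓ 1)
        ∎

  q-one : q 1 ≡ ℕtoℚ (n ∸ 1) ÷ℕ k ℓ
  q-one = trans (ℚP.+-identityˡ (step 0)) (cong₂ _÷ℕ_ numerator denominator)
    where
    1≤n : 1 ≤ n
    1≤n = subst (_≤ n) (kk-zero G x₀) (B≤n 0 z≤n)
    numerator : ℕtoℚ n - ℕtoℚ (K 0) ≡ ℕtoℚ (n ∸ 1)
    numerator = trans (cong (λ v → ℕtoℚ n - ℕtoℚ v) (kk-zero G x₀)) (sym (ℕtoℚ-∸ n 1 1≤n))
    denominator : K 0 ℕ.* b ℓ 0 ≡ k ℓ
    denominator = trans (cong₂ ℕ._*_ (kk-zero G x₀) b₀≡k) (ℕP.*-identityˡ (k ℓ))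

  q-two : 2 ≤ D ℓ → q 2 ≡ (ℕtoℚ (n ∸ 1) ÷ℕ k ℓ)
                          + ((ℕtoℚ n - ℕtoℚ 1 - ℕtoℚ (k ℓ)) ÷ℕ (k ℓ ℕ.* (k (flip ℓ) ∸ 1)))
  q-two 2≤D = cong₂ _+_ q-one (cong₂ _÷ℕ_ numerator (cong₂ ℕ._*_ K₁≡k (b₁≡k̄∸1 2≤D)))
    where
    numerator : beyond 1 ≡ ℕtoℚ n - ℕtoℚ 1 - ℕtoℚ (k ℓ)
    numerator = trans (beyond-suc 0) (cong₂ (λ u v → ℕtoℚ n - ℕtoℚ u - ℕtoℚ v) (kk-zero G x₀) K₁≡k)

proposition3p4 : (n : ℕ) → 2 ≤ n → (G : Graph n)
    → (side : Fin n → Fin 2) (k : Fin 2 → ℕ) (c b : Fin 2 → ℕ → ℕ) (D : Fin 2 → ℕ)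
    → DistanceBiregular G side k c b D
    → (ℓ : Fin 2)
    → ∃ λ (q : ℕ → ℚ) →
        (∀ x → side x ≡ ℓ → (ν : Fin n → ℚ) → IsEquilibrium G x ν
          → ∀ y m → m ≤ D ℓ → ((ν y ≡ q m) ⇔ Dist G x y m))
        × (∀ x → side x ≡ ℓ → ∀ m → m ≤ D ℓ →
            (q m ≡ sumTo m (λ j → (ℕtoℚ n - ℕtoℚ (BB G x j)) ÷ℕ (kk G x j ℕ.* b ℓ j)))
            × (q m ≡ sumTo m (λ j → (ℕtoℚ n - ℕtoℚ (BB G x j))
                                     ÷ℕ (kk G x (suc j) ℕ.* c ℓ (suc j)))))
        × (1 ≤ D ℓ → q 1 ≡ ℕtoℚ (n ∸ 1) ÷ℕ k ℓ)
        × (2 ≤ D ℓ → q 2 ≡ (ℕtoℚ (n ∸ 1) ÷ℕ k ℓ)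
                            + ((ℕtoℚ n - ℕtoℚ 1 - ℕtoℚ (k ℓ)) ÷ℕ (k ℓ ℕ.* (k (flip ℓ) ∸ 1))))
proposition3p4 n _ G side k c b D dbr ℓ =
  q , equilibrium⇔dist
    , (λ x side-x m m≤D → q≡∑-kk*b x side-x m m≤D , q≡∑-kk*c x side-x m m≤D)
    , (λ _ → q-one)
    , q-two
  where open DistanceBiregularSide {k = k} {c = c} {b = b} dbr ℓ
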